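{- Let $q,b$ be positive integers with $\gcd(q,b)=1$ and let $\alpha$ be real. Then \[K(qb,\alpha b)=\sum_{d_1d_2=b}\frac{\mu(d_1)}{d_1}K(q,\alpha d_2),\] the sum being over pairs of positive integers $(d_1,d_2)$ with $d_1d_2=b$.
   Context: $\mu$ is the Möbius function, $B(x)=\{x\}-\frac12$ with $\{x\}=x-\lfloor x\rfloor$, and for a positive integer $q$ and real $\alpha$, $K(q,\alpha)=-\sum_{d\mid q}\frac{\mu(d)}{d}B\big(\frac{\alpha}{d}\big)$ (sum over positive divisors). -}

module Defs where

open import Level using (0ℓ)
open import Data.Nat as ℕ using (ℕ; zero; suc)
open import Data.Nat.Divisibility using (_∣?_)
open import Data.Nat.Primality using (prime?)
open import Data.Integer as ℤ using (ℤ; +_; -[1+_])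
open import Data.List using (List; []; _∷_; filter; upTo; length; foldr; map; concatMap)
open import Data.Bool.ListAction using (any)
open import Data.Product using (_×_; _,_; Σ; ∃)
open import Data.Bool using (if_then_else_)
open import Relation.Nullary using (¬_)
open import Relation.Nullary.Decidable using (⌊_⌋)
open import Relation.Binary.PropositionalEquality using (_≡_; _≢_)
open import Relation.Binary.Structures using (IsTotalOrder)
open import Algebra.Structures using (IsCommutativeRing)

-- positive divisors of n (for n ≥ 1): all d ∈ {0,…,n} with d ∣ n
divisors : ℕ → List ℕ
divisors n = filter (λ d → d ∣? n) (upTo (suc n))

divisorPairs : ℕ → List (ℕ × ℕ)
divisorPairs n =
  filter (λ p → (Data.Product.proj₁ p ℕ.* Data.Product.proj₂ p) ℕ.≟ n)
         (concatMap (λ d₁ → map (λ d₂ → (d₁ , d₂)) (divisors n)) (divisors n))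

hasSquareFactor : ℕ → Data.Bool.Bool
hasSquareFactor n = any (λ k → ⌊ (suc (suc k) ℕ.* suc (suc k)) ∣? n ⌋) (upTo n)

ω : ℕ → ℕ
ω n = length (filter (λ p → Relation.Nullary.Decidable._×-dec_ (prime? p) (p ∣? n)) (upTo (suc n)))

μ : ℕ → ℤ
μ n = if hasSquareFactor n then + 0 else (ℤ.- ℤ.+ 1) ℤ.^ ω n

-- The real numbers, axiomatised as a complete ordered field with floor.
-- (The standard library has no reals; the theorem is stated for every
-- model of these axioms, i.e. for ℝ.)

record RealOps : Set₁ where
  infixl 6 _+_
  infixl 7 _*_
  infix 4 _≤_
  infix 8 -_
  infix 9 _⁻¹
  field
    R   : Set
    _+_ _*_ : R → R → R
    -_  : R → R
    0# 1# : R
    -- multiplicative inverse (total; value at 0 irrelevant)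
    _⁻¹ : R → R
    _≤_ : R → R → Set
    floor : R → ℤ

module Derived (O : RealOps) where
  open RealOps O

  infix 4 _<_
  infixl 6 _-_
  _<_ : R → R → Set
  x < y = (x ≤ y) × (x ≢ y)

  fromℕ : ℕ → R
  fromℕ zero = 0#
  fromℕ (suc n) = 1# + fromℕ n

  fromℤ : ℤ → R
  fromℤ (+ n) = fromℕ n
  fromℤ -[1+ n ] = - fromℕ (suc n)

  _-_ : R → R → R
  x - y = x + (- y)

  frac : R → R
  frac x = x - fromℤ (floor x)

  B : R → R
  B x = frac x - (1# + 1#) ⁻¹

  Σ-list : {A : Set} → List A → (A → R) → R
  Σ-list xs f = foldr (λ a s → f a + s) 0# xs

  K : ℕ → R → R
  K q α = - Σ-list (divisors q)
                   (λ d → fromℤ (μ d) * fromℕ d ⁻¹ * B (α * fromℕ d ⁻¹))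

record RealField : Set₁ where
  field
    ops : RealOps
  open RealOps ops
  open Derived ops
  field
    isCommutativeRing : IsCommutativeRing _≡_ _+_ _*_ -_ 0# 1#
    inverse : ∀ x → x ≢ 0# → x * (x ⁻¹) ≡ 1#
    0≢1 : 0# ≢ 1#
    isTotalOrder : IsTotalOrder _≡_ _≤_
    +-mono-≤ : ∀ {x y} z → x ≤ y → x + z ≤ y + z
    *-nonneg : ∀ {x y} → 0# ≤ x → 0# ≤ y → 0# ≤ x * y
    sup : (P : R → Set) → ∃ P → ∃ (λ u → ∀ x → P x → x ≤ u) →
          Σ R (λ s → (∀ x → P x → x ≤ s) × (∀ u → (∀ x → P x → x ≤ u) → s ≤ u))
    floor-≤ : ∀ x → fromℤ (floor x) ≤ x
    floor-> : ∀ x → x < fromℤ (floor x) + 1#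
  open RealOps ops public
  open Derived ops public

module Submission where

-- Since q and b are coprime,
-- (d₁ , d₂ , d') ↦ d₁d' is a bijection from the triples with d₁d₂ = b and d' ∣ q onto the
-- divisors of qb, so the divisor list of qb is a permutation of the joined triples.
-- After this reindexing, d₁ and d' are coprime, so μ(d₁d')/(d₁d') = μ(d₁)/d₁ · μ(d')/d',
-- and αb/(d₁d') = αd₂/d'.  The sum therefore splits as a double sum over the pairs
-- (d₁ , d₂) and the divisors d' of q, whose inner sum is μ(d₁)/d₁ · K(q, αd₂).

open import Defs
open import Data.Nat using (ℕ; _≥_)
open import Data.Nat.GCD using (gcd)
open import Data.Product using (_×_; _,_)
open import Relation.Binary.PropositionalEquality using (_≡_)
open import Data.Nat.Base using (>-nonZero)
open import Data.Nat.Coprimality using (gcd≡1⇒coprime)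

module DivisorLists where
  open import Data.Nat
  open import Data.Nat.Properties using (*-comm)
  open import Data.Nat.Divisibility
  open import Data.List using (List; []; _∷_; _++_; map; filter; upTo; concatMap; cartesianProduct)
  open import Data.List.Membership.Propositional using (_∈_)
  open import Data.List.Membership.Propositional.Properties
    using (∈-filter⁺; ∈-filter⁻; ∈-upTo⁺; ∈-cartesianProduct⁺)
  open import Data.List.Relation.Unary.Unique.Propositional using (Unique)
  import Data.List.Relation.Unary.Unique.Propositional.Properties as Unique
  open import Data.Product using (_×_; _,_; proj₁; proj₂)
  open import Relation.Nullary using (contradiction)
  open import Relation.Binary.PropositionalEquality

  factor∣ : ∀ {d₁ d₂ n} → d₁ * d₂ ≡ n → d₁ ∣ n
  factor∣ {d₁} {d₂} eq = divides d₂ (trans (sym eq) (*-comm d₁ d₂))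

  divisor-nonZero : ∀ {d n} → .{{NonZero n}} → d ∣ n → NonZero d
  divisor-nonZero {zero}  {n} 0∣n = contradiction (0∣⇒≡0 0∣n) (≢-nonZero⁻¹ n)
  divisor-nonZero {suc d} _       = _

  concatMap-pairs : {A B : Set} (xs : List A) (ys : List B) →
    concatMap (λ x → map (λ y → (x , y)) ys) xs ≡ cartesianProduct xs ys
  concatMap-pairs []       ys = refl
  concatMap-pairs (x ∷ xs) ys = cong (map (x ,_) ys ++_) (concatMap-pairs xs ys)

  divisorPairs-filter : ∀ n → divisorPairs n ≡
    filter (λ p → proj₁ p * proj₂ p ≟ n) (cartesianProduct (divisors n) (divisors n))
  divisorPairs-filter n = cong (filter _) (concatMap-pairs (divisors n) (divisors n))

  ∈-divisors⁺ : ∀ {d n} → .{{NonZero n}} → d ∣ n → d ∈ divisors n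
  ∈-divisors⁺ {n = n} d∣n = ∈-filter⁺ (_∣? n) (∈-upTo⁺ (s≤s (∣⇒≤ d∣n))) d∣n

  ∈-divisors⁻ : ∀ {d n} → d ∈ divisors n → d ∣ n
  ∈-divisors⁻ {n = n} d∈ = proj₂ (∈-filter⁻ (_∣? n) {xs = upTo (suc n)} d∈)

  divisors-unique : ∀ n → Unique (divisors n)
  divisors-unique n = Unique.filter⁺ (_∣? n) (Unique.upTo⁺ (suc n))

  ∈-divisorPairs⁺ : ∀ {d₁ d₂ n} → .{{NonZero n}} → d₁ * d₂ ≡ n → (d₁ , d₂) ∈ divisorPairs n
  ∈-divisorPairs⁺ {d₁} {d₂} {n} eq = subst ((d₁ , d₂) ∈_) (sym (divisorPairs-filter n))
    (∈-filter⁺ (λ p → proj₁ p * proj₂ p ≟ n)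
      (∈-cartesianProduct⁺ (∈-divisors⁺ (factor∣ eq)) (∈-divisors⁺ (divides d₁ (sym eq))))
      eq)

  ∈-divisorPairs⁻ : ∀ {d₁ d₂ n} → (d₁ , d₂) ∈ divisorPairs n → d₁ * d₂ ≡ n
  ∈-divisorPairs⁻ {n = n} p∈ =
    proj₂ (∈-filter⁻ (λ p → proj₁ p * proj₂ p ≟ n)
      {xs = cartesianProduct (divisors n) (divisors n)} (subst (_ ∈_) (divisorPairs-filter n) p∈))

  divisorPairs-unique : ∀ n → Unique (divisorPairs n)
  divisorPairs-unique n = subst Unique (sym (divisorPairs-filter n))
    (Unique.filter⁺ (λ p → proj₁ p * proj₂ p ≟ n)
      (Unique.cartesianProduct⁺ (divisors-unique n) (divisors-unique n)))

module CoprimeDivisors where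
  open import Data.Nat
  open import Data.Nat.Properties
  open import Data.Nat.Divisibility
  open import Data.Nat.GCD
  open import Data.Nat.Coprimality using (Coprime; coprime-divisor; gcd≡1⇒coprime)
  import Data.Nat.Coprimality as Coprime
  open import Data.List using (List; []; _∷_; map; cartesianProduct)
  open import Data.List.Membership.Propositional using (_∈_)
  open import Data.List.Membership.Propositional.Properties
    using (∈-map⁺; ∈-map⁻; ∈-cartesianProduct⁺; ∈-cartesianProduct⁻)
  open import Data.List.Membership.Propositional.Properties.WithK using (unique∧set⇒bag)
  open import Data.List.Relation.Unary.Any using (here; there)
  import Data.List.Relation.Unary.All as All
  import Data.List.Relation.Unary.All.Properties as All
  open import Data.List.Relation.Unary.AllPairs using ([]; _∷_)
  open import Data.List.Relation.Unary.Unique.Propositional using (Unique)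
  import Data.List.Relation.Unary.Unique.Propositional.Properties as Unique
  open import Data.List.Relation.Binary.Permutation.Propositional using (_↭_)
  open import Data.List.Relation.Binary.BagAndSetEquality using (∼bag⇒↭)
  open import Data.Product using (_×_; _,_; ∃-syntax)
  open import Data.Sum using (inj₂)
  open import Function.Bundles using (mk⇔)
  open import Relation.Binary.PropositionalEquality
  open DivisorLists

  -- Every divisor d of qb is d₁ d' with d₁ ∣ b and d' ∣ q: take d₁ = gcd d b; the
  -- cofactor d' = d / d₁ is coprime to b / d₁ and divides q (b / d₁).
  divisor-split : ∀ {q b d} → .{{NonZero b}} → d ∣ q * b →
    ∃[ d₁ ] ∃[ d' ] d₁ ∣ b × d' ∣ q × d ≡ d₁ * d'
  divisor-split {q} {b} {d} d∣qb with gcd[m,n]∣m d b | gcd[m,n]∣n d b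
  ... | divides d' d≡d'g | divides b' b≡b'g =
    g , d' , divides b' b≡b'g , d'∣q , trans d≡d'g (*-comm d' g)
    where
    g = gcd d b
    instance
      g≢0 : NonZero g
      g≢0 = ≢-nonZero (gcd[m,n]≢0 d b (inj₂ (≢-nonZero⁻¹ b)))
    cofactors-coprime : Coprime d' b'
    cofactors-coprime = gcd≡1⇒coprime (*-cancelˡ-≡ (gcd d' b') 1 g (begin
      g * gcd d' b'          ≡⟨ c*gcd[m,n]≡gcd[cm,cn] g d' b' ⟩
      gcd (g * d') (g * b')  ≡⟨ cong₂ gcd (trans (*-comm g d') (sym d≡d'g))
                                         (trans (*-comm g b') (sym b≡b'g)) ⟩
      g                      ≡⟨ *-identityʳ g ⟨
      g * 1                  ∎))
      where open ≡-Reasoning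
    d'∣qb' : d' ∣ q * b'
    d'∣qb' = *-cancelʳ-∣ g
      (subst₂ _∣_ d≡d'g (trans (cong (q *_) b≡b'g) (sym (*-assoc q b' g))) d∣qb)
    d'∣q : d' ∣ q
    d'∣q = coprime-divisor cofactors-coprime (subst (d' ∣_) (*-comm q b') d'∣qb')

  coprime-divisors : ∀ {m n a c} → Coprime m n → a ∣ m → c ∣ n → Coprime a c
  coprime-divisors cop a∣m c∣n (x∣a , x∣c) = cop (∣-trans x∣a a∣m , ∣-trans x∣c c∣n)

  divisor-split-unique : ∀ {q b d₁ e₁ d' e'} → .{{NonZero b}} → Coprime q b →
    d₁ ∣ b → e₁ ∣ b → d' ∣ q → e' ∣ q →
    d₁ * d' ≡ e₁ * e' → d₁ ≡ e₁ × d' ≡ e'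
  divisor-split-unique {d₁ = d₁} {e₁} {d'} {e'} cop d₁∣b e₁∣b d'∣q e'∣q eq =
    d₁≡e₁ , *-cancelˡ-≡ d' e' d₁ {{divisor-nonZero d₁∣b}} (trans eq (cong (_* e') (sym d₁≡e₁)))
    where
    d₁∣e₁ : d₁ ∣ e₁
    d₁∣e₁ = coprime-divisor (coprime-divisors (Coprime.sym cop) d₁∣b e'∣q)
      (divides d' (trans (*-comm e' e₁) (trans (sym eq) (*-comm d₁ d'))))
    e₁∣d₁ : e₁ ∣ d₁
    e₁∣d₁ = coprime-divisor (coprime-divisors (Coprime.sym cop) e₁∣b d'∣q)
      (divides e' (trans (*-comm d' d₁) (trans eq (*-comm e₁ e'))))
    d₁≡e₁ : d₁ ≡ e₁
    d₁≡e₁ = ∣-antisym d₁∣e₁ e₁∣d₁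

  map-unique : {A B : Set} (f : A → B) {xs : List A} → Unique xs →
    (∀ {x y} → x ∈ xs → y ∈ xs → f x ≡ f y → x ≡ y) → Unique (map f xs)
  map-unique f []           inj = []
  map-unique f (x∉ ∷ unique) inj =
    All.map⁺ (All.tabulate (λ y∈ fx≡fy → All.lookup x∉ y∈ (inj (here refl) (there y∈) fx≡fy)))
    ∷ map-unique f unique (λ x∈ y∈ → inj (there x∈) (there y∈))

  Triples : ℕ → ℕ → List ((ℕ × ℕ) × ℕ)
  Triples q b = cartesianProduct (divisorPairs b) (divisors q)

  join : (ℕ × ℕ) × ℕ → ℕ
  join ((d₁ , _) , d') = d₁ * d'

  ∈-Triples⁻ : ∀ {q b d₁ d₂ d'} → ((d₁ , d₂) , d') ∈ Triples q b → d₁ * d₂ ≡ b × d' ∣ q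
  ∈-Triples⁻ {q} {b} t∈ with p∈ , d'∈ ← ∈-cartesianProduct⁻ (divisorPairs b) (divisors q) t∈ =
    ∈-divisorPairs⁻ p∈ , ∈-divisors⁻ d'∈

  divisors-coprime-* : ∀ {q b} → .{{NonZero q}} → .{{NonZero b}} → Coprime q b →
    divisors (q * b) ↭ map join (Triples q b)
  divisors-coprime-* {q} {b} cop = ∼bag⇒↭ (unique∧set⇒bag
    (divisors-unique (q * b))
    (map-unique join (Unique.cartesianProduct⁺ (divisorPairs-unique b) (divisors-unique q))
                join-injective)
    (mk⇔ join-onto join-into))
    where
    instance
      qb≢0 : NonZero (q * b)
      qb≢0 = m*n≢0 q b

    join-injective : ∀ {s t} → s ∈ Triples q b → t ∈ Triples q b → join s ≡ join t → s ≡ t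
    join-injective {(d₁ , d₂) , d'} {(e₁ , e₂) , e'} s∈ t∈ d₁d'≡e₁e'
      with d₁d₂≡b , d'∣q ← ∈-Triples⁻ {q} {b} s∈ | e₁e₂≡b , e'∣q ← ∈-Triples⁻ {q} {b} t∈
      with refl , refl ← divisor-split-unique {d₁ = d₁} {e₁} {d'} {e'}
                           cop (factor∣ d₁d₂≡b) (factor∣ e₁e₂≡b) d'∣q e'∣q d₁d'≡e₁e'
      = cong (λ d₂ → (d₁ , d₂) , d')
          (*-cancelˡ-≡ d₂ e₂ d₁ {{divisor-nonZero (factor∣ d₁d₂≡b)}} (trans d₁d₂≡b (sym e₁e₂≡b)))

    join-onto : ∀ {d} → d ∈ divisors (q * b) → d ∈ map join (Triples q b)
    join-onto d∈
      with d₁ , d' , divides d₂ b≡d₂d₁ , d'∣q , refl ← divisor-split {q} {b} (∈-divisors⁻ d∈) =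
      ∈-map⁺ join (∈-cartesianProduct⁺
        (∈-divisorPairs⁺ {d₁} {d₂} (trans (*-comm d₁ d₂) (sym b≡d₂d₁))) (∈-divisors⁺ d'∣q))

    join-into : ∀ {d} → d ∈ map join (Triples q b) → d ∈ divisors (q * b)
    join-into d∈ with ((d₁ , d₂) , d') , t∈ , refl ← ∈-map⁻ join d∈
      with d₁d₂≡b , d'∣q ← ∈-Triples⁻ {q} {b} t∈ =
      ∈-divisors⁺ (subst (_∣ q * b) (*-comm d' d₁) (*-pres-∣ d'∣q (factor∣ d₁d₂≡b)))

module Möbius where
  open import Data.Nat
  open import Data.Nat.Properties
  open import Data.Nat.Divisibility
  open import Data.Nat.Coprimality using (Coprime)
  import Data.Nat.Coprimality as Coprime
  open import Data.Nat.Primality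
  open import Data.Nat.Primality.Factorisation using (factorise)
  open import Data.Nat.ListAction using (product)
  import Data.Integer as ℤ
  import Data.Integer.Properties as ℤ
  open import Data.Bool using (true; false; T; _∨_; if_then_else_)
  open import Data.Bool.Properties using (T-∨)
  open import Data.Bool.ListAction using (any)
  open import Data.List using ([]; _∷_; _++_; [_]; length; filter; upTo)
  open import Data.List.Properties using (filter-++; filter-reject; upTo-∷ʳ; ++-identityʳ)
  open import Data.List.Membership.Propositional using (lose)
  open import Data.List.Membership.Propositional.Properties using (∈-upTo⁺)
  open import Data.List.Relation.Unary.All using (_∷_)
  open import Data.List.Relation.Unary.Any using (satisfied)
  open import Data.List.Relation.Unary.Any.Properties using (any⁺; any⁻)
  open import Data.Product using (_×_; _,_; proj₂; ∃-syntax)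
  open import Data.Sum using (_⊎_; inj₁; inj₂)
  open import Data.Sum.Function.Propositional using (_⊎-⇔_)
  open import Data.Empty using (⊥; ⊥-elim)
  open import Data.Unit using (tt)
  open import Function.Bundles using (_⇔_; mk⇔; Equivalence)
  import Function.Properties.Equivalence as ⇔
  open import Relation.Nullary using (¬_; yes; no)
  open import Relation.Nullary.Decidable using (_×-dec_; toWitness; fromWitness)
  open import Level using (0ℓ)
  open import Relation.Unary using (Pred; Decidable)
  open import Relation.Binary.PropositionalEquality hiding ([_])
  open ≡-Reasoning

  filter-upTo-beyond : ∀ {P : Pred ℕ 0ℓ} (P? : Decidable P) {m} → (∀ {x} → P x → x ≤ m) →
    ∀ k → filter P? (upTo (suc (k + m))) ≡ filter P? (upTo (suc m))
  filter-upTo-beyond P?     bound zero    = refl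
  filter-upTo-beyond P? {m} bound (suc k) = begin
    filter P? (upTo (suc (suc k + m)))
      ≡⟨ cong (filter P?) (upTo-∷ʳ (suc (k + m))) ⟨
    filter P? (upTo (suc (k + m)) ++ [ suc (k + m) ])
      ≡⟨ filter-++ P? (upTo (suc (k + m))) _ ⟩
    filter P? (upTo (suc (k + m))) ++ filter P? [ suc (k + m) ]
      ≡⟨ cong₂ _++_ (filter-upTo-beyond P? bound k) last-rejected ⟩
    filter P? (upTo (suc m)) ++ []
      ≡⟨ ++-identityʳ _ ⟩
    filter P? (upTo (suc m)) ∎
    where
    last-rejected : filter P? [ suc (k + m) ] ≡ []
    last-rejected = filter-reject P? (λ p → <⇒≱ (s≤s (m≤n+m m k)) (bound p))

  length-filter-⊎ : {A : Set} {P Q R : Pred A 0ℓ}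
    (P? : Decidable P) (Q? : Decidable Q) (R? : Decidable R) →
    (∀ {x} → P x → Q x → ⊥) → (∀ {x} → R x ⇔ (P x ⊎ Q x)) →
    ∀ xs → length (filter R? xs) ≡ length (filter P? xs) + length (filter Q? xs)
  length-filter-⊎ P? Q? R? disjoint R⇔P⊎Q [] = refl
  length-filter-⊎ P? Q? R? disjoint R⇔P⊎Q (x ∷ xs) with R? x | P? x | Q? x
  ... | yes _  | yes p  | yes q  = ⊥-elim (disjoint p q)
  ... | yes _  | yes _  | no _   = cong suc (length-filter-⊎ P? Q? R? disjoint R⇔P⊎Q xs)
  ... | yes _  | no _   | yes _  =
    trans (cong suc (length-filter-⊎ P? Q? R? disjoint R⇔P⊎Q xs)) (sym (+-suc _ _))
  ... | yes r  | no ¬p  | no ¬q  with Equivalence.to R⇔P⊎Q r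
  ...   | inj₁ p = ⊥-elim (¬p p)
  ...   | inj₂ q = ⊥-elim (¬q q)
  length-filter-⊎ P? Q? R? disjoint R⇔P⊎Q (x ∷ xs) | no ¬r | yes p | _ =
    ⊥-elim (¬r (Equivalence.from R⇔P⊎Q (inj₁ p)))
  length-filter-⊎ P? Q? R? disjoint R⇔P⊎Q (x ∷ xs) | no ¬r | no _ | yes q =
    ⊥-elim (¬r (Equivalence.from R⇔P⊎Q (inj₂ q)))
  length-filter-⊎ P? Q? R? disjoint R⇔P⊎Q (x ∷ xs) | no _  | no _ | no _ =
    length-filter-⊎ P? Q? R? disjoint R⇔P⊎Q xs

  primeDivisor? : ∀ n → Decidable (λ p → Prime p × p ∣ n)
  primeDivisor? n p = prime? p ×-dec p ∣? n

  ω-upTo : ∀ {m N} → .{{NonZero m}} → m ≤ N →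
    length (filter (primeDivisor? m) (upTo (suc N))) ≡ ω m
  ω-upTo {m} {N} m≤N = cong length (begin
    filter (primeDivisor? m) (upTo (suc N))
      ≡⟨ cong (λ k → filter (primeDivisor? m) (upTo (suc k))) (m∸n+n≡m m≤N) ⟨
    filter (primeDivisor? m) (upTo (suc (N ∸ m + m)))
      ≡⟨ filter-upTo-beyond (primeDivisor? m) (λ p → ∣⇒≤ (proj₂ p)) (N ∸ m) ⟩
    filter (primeDivisor? m) (upTo (suc m)) ∎)

  prime-∤-coprime : ∀ {p m n} → Coprime m n → Prime p → p ∣ m → ¬ p ∣ n
  prime-∤-coprime cop p-prime p∣m p∣n = ¬prime[1] (subst Prime (cop (p∣m , p∣n)) p-prime)

  primeDivisor-* : ∀ {m n p} → (Prime p × p ∣ m * n) ⇔ ((Prime p × p ∣ m) ⊎ (Prime p × p ∣ n))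
  primeDivisor-* {m} {n} = mk⇔ to from
    where
    to : ∀ {p} → Prime p × p ∣ m * n → (Prime p × p ∣ m) ⊎ (Prime p × p ∣ n)
    to (p-prime , p∣mn) with euclidsLemma m n p-prime p∣mn
    ... | inj₁ p∣m = inj₁ (p-prime , p∣m)
    ... | inj₂ p∣n = inj₂ (p-prime , p∣n)
    from : ∀ {p} → (Prime p × p ∣ m) ⊎ (Prime p × p ∣ n) → Prime p × p ∣ m * n
    from (inj₁ (p-prime , p∣m)) = p-prime , ∣-trans p∣m (m∣m*n n)
    from (inj₂ (p-prime , p∣n)) = p-prime , ∣-trans p∣n (n∣m*n m)

  ω-* : ∀ {m n} → .{{NonZero m}} → .{{NonZero n}} → Coprime m n → ω (m * n) ≡ ω m + ω n
  ω-* {m} {n} cop = begin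
    ω (m * n)
      ≡⟨ length-filter-⊎ (primeDivisor? m) (primeDivisor? n) (primeDivisor? (m * n))
           (λ (p-prime , p∣m) (_ , p∣n) → prime-∤-coprime cop p-prime p∣m p∣n)
           primeDivisor-* (upTo (suc (m * n))) ⟩
    length (filter (primeDivisor? m) (upTo (suc (m * n))))
      + length (filter (primeDivisor? n) (upTo (suc (m * n))))
      ≡⟨ cong₂ _+_ (ω-upTo (m≤m*n m n)) (ω-upTo (m≤n*m n m)) ⟩
    ω m + ω n ∎

  HasPrimeSquare : ℕ → Set
  HasPrimeSquare n = ∃[ p ] Prime p × p * p ∣ n

  prime-factor : ∀ k → ∃[ p ] Prime p × p ∣ suc (suc k)
  prime-factor k with factorise (suc (suc k))
  ... | record { factors = [] ; isFactorisation = () }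
  ... | record { factors = p ∷ ps ; isFactorisation = n≡Πps ; factorsPrime = p-prime ∷ _ } =
    p , p-prime , subst (p ∣_) (sym n≡Πps) (m∣m*n (product ps))

  -- hasSquareFactor n (a search for (k + 2)² ∣ n with k < n) decides HasPrimeSquare n:
  -- a square dividing n yields p² ∣ n for any prime p dividing its root, and a prime p
  -- with p² ∣ n is itself found by the search since p < p² ≤ n.
  hasSquareFactor⇔ : ∀ {n} → .{{NonZero n}} → T (hasSquareFactor n) ⇔ HasPrimeSquare n
  hasSquareFactor⇔ {n} = mk⇔ to from
    where
    to : T (hasSquareFactor n) → HasPrimeSquare n
    to found with k , k²∣n ← satisfied (any⁻ _ (upTo n) found)
             with p , p-prime , p∣k ← prime-factor k =
      p , p-prime , ∣-trans (*-pres-∣ p∣k p∣k) (toWitness k²∣n)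
    from : HasPrimeSquare n → T (hasSquareFactor n)
    from (0                , p-prime , _)    = ⊥-elim (¬prime[0] p-prime)
    from (1                , p-prime , _)    = ⊥-elim (¬prime[1] p-prime)
    from (p@(suc (suc k)) , _       , p²∣n) = any⁺ _ (lose (∈-upTo⁺ k<n) (fromWitness p²∣n))
      where
      k<n : k < n
      k<n = ≤-trans (n≤1+n (suc k)) (≤-trans (m≤m*n p p) (∣⇒≤ p²∣n))

  prime-square-∣ : ∀ {p m n} → Prime p → p * p ∣ m * n → ¬ p ∣ n → p * p ∣ m
  prime-square-∣ {p} {m} {n} p-prime p²∣mn p∤n
    with euclidsLemma m n p-prime (∣-trans (m∣m*n p) p²∣mn)
  ... | inj₂ p∣n = ⊥-elim (p∤n p∣n)
  ... | inj₁ (divides m' m≡m'p) with euclidsLemma m' n p-prime p∣m'n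
    where
    instance
      p≢0 : NonZero p
      p≢0 = prime⇒nonZero p-prime
    p∣m'n : p ∣ m' * n
    p∣m'n = *-cancelˡ-∣ p (subst (p * p ∣_)
      (trans (cong (_* n) (trans m≡m'p (*-comm m' p))) (*-assoc p m' n)) p²∣mn)
  ...   | inj₁ p∣m' = subst (p * p ∣_) (sym m≡m'p) (*-monoˡ-∣ p p∣m')
  ...   | inj₂ p∣n  = ⊥-elim (p∤n p∣n)

  hasPrimeSquare-* : ∀ {m n} → Coprime m n →
    HasPrimeSquare (m * n) ⇔ (HasPrimeSquare m ⊎ HasPrimeSquare n)
  hasPrimeSquare-* {m} {n} cop = mk⇔ to from
    where
    to : HasPrimeSquare (m * n) → HasPrimeSquare m ⊎ HasPrimeSquare n
    to (p , p-prime , p²∣mn) with euclidsLemma m n p-prime (∣-trans (m∣m*n p) p²∣mn)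
    ... | inj₁ p∣m = inj₁ (p , p-prime ,
            prime-square-∣ p-prime p²∣mn (prime-∤-coprime cop p-prime p∣m))
    ... | inj₂ p∣n = inj₂ (p , p-prime ,
            prime-square-∣ p-prime (subst (p * p ∣_) (*-comm m n) p²∣mn)
                                   (prime-∤-coprime (Coprime.sym cop) p-prime p∣n))
    from : HasPrimeSquare m ⊎ HasPrimeSquare n → HasPrimeSquare (m * n)
    from (inj₁ (p , p-prime , p²∣m)) = p , p-prime , ∣-trans p²∣m (m∣m*n n)
    from (inj₂ (p , p-prime , p²∣n)) = p , p-prime , ∣-trans p²∣n (n∣m*n m)

  T-injective : ∀ {x y} → (T x ⇔ T y) → x ≡ y
  T-injective {false} {false} _     = refl
  T-injective {false} {true}  x⇔y = ⊥-elim (Equivalence.from x⇔y tt)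
  T-injective {true}  {false} x⇔y = ⊥-elim (Equivalence.to x⇔y tt)
  T-injective {true}  {true}  _     = refl

  hasSquareFactor-* : ∀ {m n} → .{{NonZero m}} → .{{NonZero n}} → Coprime m n →
    hasSquareFactor (m * n) ≡ hasSquareFactor m ∨ hasSquareFactor n
  hasSquareFactor-* {m} {n} cop = T-injective
    (⇔.trans (hasSquareFactor⇔ {{m*n≢0 m n}})
    (⇔.trans (hasPrimeSquare-* cop)
    (⇔.trans (⇔.sym (hasSquareFactor⇔ ⊎-⇔ hasSquareFactor⇔))
             (⇔.sym T-∨))))

  if-∨-^ : ∀ b c (s : ℤ.ℤ) i j →
    (if b ∨ c then ℤ.+ 0 else s ℤ.^ (i + j))
      ≡ (if b then ℤ.+ 0 else s ℤ.^ i) ℤ.* (if c then ℤ.+ 0 else s ℤ.^ j)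
  if-∨-^ true  c     s i j = refl
  if-∨-^ false true  s i j = sym (ℤ.*-zeroʳ (s ℤ.^ i))
  if-∨-^ false false s i j = ℤ.^-distribˡ-+-* s i j

  μ-* : ∀ {m n} → .{{NonZero m}} → .{{NonZero n}} → Coprime m n → μ (m * n) ≡ μ m ℤ.* μ n
  μ-* {m} {n} cop = begin
    μ (m * n)
      ≡⟨ cong₂ (λ h w → if h then ℤ.+ 0 else ℤ.-1ℤ ℤ.^ w) (hasSquareFactor-* cop) (ω-* cop) ⟩
    (if hasSquareFactor m ∨ hasSquareFactor n then ℤ.+ 0 else ℤ.-1ℤ ℤ.^ (ω m + ω n))
      ≡⟨ if-∨-^ (hasSquareFactor m) (hasSquareFactor n) ℤ.-1ℤ (ω m) (ω n) ⟩
    μ m ℤ.* μ n ∎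

module FieldFacts (ℝ : RealField) where
  open RealField ℝ
  open import Level using (0ℓ)
  open import Data.Nat as ℕ using (ℕ; zero; suc; NonZero)
  import Data.Integer as ℤ
  open import Data.Sign as Sign using (Sign)
  open import Data.Sum using (inj₁; inj₂)
  open import Algebra.Bundles using (CommutativeRing)
  open import Algebra.Structures using (IsCommutativeRing)
  open import Relation.Binary.Structures using (IsTotalOrder)
  open import Relation.Binary.PropositionalEquality
  open ≡-Reasoning

  open IsCommutativeRing isCommutativeRing
    using (+-identityˡ; +-identityʳ; -‿inverseʳ; *-assoc; *-comm; *-identityˡ; *-identityʳ;
           zeroˡ; zeroʳ)
  open IsTotalOrder isTotalOrder
    using (total) renaming (trans to ≤-trans; antisym to ≤-antisym; refl to ≤-refl)

  commutativeRing : CommutativeRing 0ℓ 0ℓ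
  commutativeRing = record { isCommutativeRing = isCommutativeRing }

  open CommutativeRing commutativeRing using (semiring; ring; *-commutativeSemigroup; +-group)
  open import Algebra.Properties.Ring ring using (-1*x≈-x)
  open import Algebra.Properties.Group +-group using (⁻¹-involutive)
  open import Algebra.Properties.CommutativeSemigroup *-commutativeSemigroup
    using (interchange; x∙yz≈xz∙y)
  open import Algebra.Properties.Semiring.Mult semiring renaming (_×_ to _times_) using (×1-homo-*)

  fromℕ-times : ∀ n → fromℕ n ≡ n times 1#
  fromℕ-times zero    = refl
  fromℕ-times (suc n) = cong (1# +_) (fromℕ-times n)

  fromℕ-* : ∀ m n → fromℕ (m ℕ.* n) ≡ fromℕ m * fromℕ n
  fromℕ-* m n = begin
    fromℕ (m ℕ.* n)              ≡⟨ fromℕ-times (m ℕ.* n) ⟩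
    (m ℕ.* n) times 1#           ≡⟨ ×1-homo-* m n ⟩
    (m times 1#) * (n times 1#)  ≡⟨ cong₂ _*_ (fromℕ-times m) (fromℕ-times n) ⟨
    fromℕ m * fromℕ n            ∎

  -- The embedding of ℤ is multiplicative: write i = sign i · |i|.
  signR : Sign → R
  signR Sign.+ = 1#
  signR Sign.- = - 1#

  signR-* : ∀ s t → signR (s Sign.* t) ≡ signR s * signR t
  signR-* Sign.+ t      = sym (*-identityˡ _)
  signR-* Sign.- Sign.+ = sym (*-identityʳ _)
  signR-* Sign.- Sign.- = sym (trans (-1*x≈-x (- 1#)) (⁻¹-involutive 1#))

  fromℤ-◃ : ∀ s n → fromℤ (s ℤ.◃ n) ≡ signR s * fromℕ n
  fromℤ-◃ s      zero    = sym (zeroʳ _)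
  fromℤ-◃ Sign.+ (suc n) = sym (*-identityˡ _)
  fromℤ-◃ Sign.- (suc n) = sym (-1*x≈-x _)

  fromℤ-sign-abs : ∀ i → fromℤ i ≡ signR (ℤ.sign i) * fromℕ ℤ.∣ i ∣
  fromℤ-sign-abs (ℤ.+ n)    = sym (*-identityˡ _)
  fromℤ-sign-abs ℤ.-[1+ n ] = sym (-1*x≈-x _)

  fromℤ-* : ∀ i j → fromℤ (i ℤ.* j) ≡ fromℤ i * fromℤ j
  fromℤ-* i j = begin
    fromℤ (i ℤ.* j)
      ≡⟨ fromℤ-◃ (ℤ.sign i Sign.* ℤ.sign j) (ℤ.∣ i ∣ ℕ.* ℤ.∣ j ∣) ⟩
    signR (ℤ.sign i Sign.* ℤ.sign j) * fromℕ (ℤ.∣ i ∣ ℕ.* ℤ.∣ j ∣)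
      ≡⟨ cong₂ _*_ (signR-* (ℤ.sign i) (ℤ.sign j)) (fromℕ-* ℤ.∣ i ∣ ℤ.∣ j ∣) ⟩
    (signR (ℤ.sign i) * signR (ℤ.sign j)) * (fromℕ ℤ.∣ i ∣ * fromℕ ℤ.∣ j ∣)
      ≡⟨ interchange _ _ _ _ ⟩
    (signR (ℤ.sign i) * fromℕ ℤ.∣ i ∣) * (signR (ℤ.sign j) * fromℕ ℤ.∣ j ∣)
      ≡⟨ cong₂ _*_ (fromℤ-sign-abs i) (fromℤ-sign-abs j) ⟨
    fromℤ i * fromℤ j ∎

  -- Characteristic zero: the order forces 0 < 1 ≤ n for every positive integer n.
  0≤1 : 0# ≤ 1#
  0≤1 with total 0# 1#
  ... | inj₁ 0≤1 = 0≤1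
  ... | inj₂ 1≤0 = subst (0# ≤_) (trans (-1*x≈-x (- 1#)) (⁻¹-involutive 1#)) (*-nonneg 0≤-1 0≤-1)
    where
    0≤-1 : 0# ≤ - 1#
    0≤-1 = subst₂ _≤_ (-‿inverseʳ 1#) (+-identityˡ _) (+-mono-≤ (- 1#) 1≤0)

  1≤fromℕ : ∀ n → 1# ≤ fromℕ (suc n)
  1≤fromℕ zero    = subst (1# ≤_) (sym (+-identityʳ 1#)) ≤-refl
  1≤fromℕ (suc n) = ≤-trans (1≤fromℕ n)
    (subst (_≤ fromℕ (suc (suc n))) (+-identityˡ _) (+-mono-≤ (fromℕ (suc n)) 0≤1))

  fromℕ-nonZero : ∀ n → .{{NonZero n}} → fromℕ n ≢ 0#
  fromℕ-nonZero (suc n) n≡0 = 0≢1 (≤-antisym 0≤1 (subst (1# ≤_) n≡0 (1≤fromℕ n)))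

  ⁻¹-unique : ∀ x y → x ≢ 0# → x * y ≡ 1# → y ≡ x ⁻¹
  ⁻¹-unique x y x≢0 xy≡1 = begin
    y                ≡⟨ *-identityˡ y ⟨
    1# * y           ≡⟨ cong (_* y) (trans (*-comm (x ⁻¹) x) (inverse x x≢0)) ⟨
    (x ⁻¹ * x) * y   ≡⟨ *-assoc _ _ _ ⟩
    x ⁻¹ * (x * y)   ≡⟨ cong (x ⁻¹ *_) xy≡1 ⟩
    x ⁻¹ * 1#        ≡⟨ *-identityʳ _ ⟩
    x ⁻¹             ∎

  *-nonZero : ∀ x y → x ≢ 0# → y ≢ 0# → x * y ≢ 0#
  *-nonZero x y x≢0 y≢0 xy≡0 = x≢0 (begin
    x                ≡⟨ *-identityʳ x ⟨
    x * 1#           ≡⟨ cong (x *_) (inverse y y≢0) ⟨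
    x * (y * y ⁻¹)   ≡⟨ *-assoc _ _ _ ⟨
    (x * y) * y ⁻¹   ≡⟨ cong (_* y ⁻¹) xy≡0 ⟩
    0# * y ⁻¹        ≡⟨ zeroˡ _ ⟩
    0#               ∎)

  ⁻¹-* : ∀ x y → x ≢ 0# → y ≢ 0# → (x * y) ⁻¹ ≡ x ⁻¹ * y ⁻¹
  ⁻¹-* x y x≢0 y≢0 = sym (⁻¹-unique (x * y) (x ⁻¹ * y ⁻¹) (*-nonZero x y x≢0 y≢0)
    (trans (interchange x y (x ⁻¹) (y ⁻¹))
      (trans (cong₂ _*_ (inverse x x≢0) (inverse y y≢0)) (*-identityˡ 1#))))

  fromℕ-*-⁻¹ : ∀ m n → .{{NonZero m}} → .{{NonZero n}} →
    fromℕ (m ℕ.* n) ⁻¹ ≡ fromℕ m ⁻¹ * fromℕ n ⁻¹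
  fromℕ-*-⁻¹ m n = trans (cong _⁻¹ (fromℕ-* m n)) (⁻¹-* _ _ (fromℕ-nonZero m) (fromℕ-nonZero n))

  cancel : ∀ x y z w → y ≢ 0# → x * (y * z) * (y ⁻¹ * w) ≡ x * z * w
  cancel x y z w y≢0 = begin
    x * (y * z) * (y ⁻¹ * w)   ≡⟨ cong (_* (y ⁻¹ * w)) (x∙yz≈xz∙y x y z) ⟩
    x * z * y * (y ⁻¹ * w)     ≡⟨ *-assoc _ _ _ ⟩
    x * z * (y * (y ⁻¹ * w))   ≡⟨ cong (x * z *_) (*-assoc _ _ _) ⟨
    x * z * (y * y ⁻¹ * w)     ≡⟨ cong (λ u → x * z * (u * w)) (inverse y y≢0) ⟩
    x * z * (1# * w)           ≡⟨ cong (x * z *_) (*-identityˡ w) ⟩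
    x * z * w                  ∎

module Sums (ℝ : RealField) where
  open RealField ℝ
  open FieldFacts ℝ using (commutativeRing)
  open import Data.List using (List; []; _∷_; _++_; map; foldr; cartesianProduct)
  open import Data.List.Membership.Propositional using (_∈_)
  open import Data.List.Relation.Unary.Any using (here; there)
  open import Data.List.Relation.Binary.Permutation.Propositional using (_↭_; ↭⇒↭ₛ)
  open import Data.List.Relation.Binary.Permutation.Propositional.Properties using (map⁺)
  open import Data.List.Relation.Binary.Permutation.Setoid.Properties using (foldr-commMonoid)
  open import Data.Product using (_×_; _,_)
  open import Algebra.Bundles using (CommutativeRing)
  open import Relation.Binary.PropositionalEquality
  open ≡-Reasoning

  open CommutativeRing commutativeRing
    using (+-identityˡ; +-assoc; zeroʳ; distribˡ; +-isCommutativeMonoid; +-abelianGroup; +-group)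
  open import Algebra.Properties.AbelianGroup +-abelianGroup using (⁻¹-∙-comm)
  open import Algebra.Properties.Group +-group using (ε⁻¹≈ε)

  private variable A C : Set

  Σ-++ : (xs ys : List A) (f : A → R) → Σ-list (xs ++ ys) f ≡ Σ-list xs f + Σ-list ys f
  Σ-++ []       ys f = sym (+-identityˡ _)
  Σ-++ (x ∷ xs) ys f = trans (cong (f x +_) (Σ-++ xs ys f)) (sym (+-assoc _ _ _))

  Σ-map : (h : A → C) (xs : List A) (f : C → R) → Σ-list (map h xs) f ≡ Σ-list xs (λ x → f (h x))
  Σ-map h []       f = refl
  Σ-map h (x ∷ xs) f = cong (f (h x) +_) (Σ-map h xs f)

  Σ-cartesianProduct : (xs : List A) (ys : List C) (f : A × C → R) →
    Σ-list (cartesianProduct xs ys) f ≡ Σ-list xs (λ x → Σ-list ys (λ y → f (x , y)))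
  Σ-cartesianProduct []       ys f = refl
  Σ-cartesianProduct (x ∷ xs) ys f = begin
    Σ-list (map (x ,_) ys ++ cartesianProduct xs ys) f
      ≡⟨ Σ-++ (map (x ,_) ys) _ f ⟩
    Σ-list (map (x ,_) ys) f + Σ-list (cartesianProduct xs ys) f
      ≡⟨ cong₂ _+_ (Σ-map (x ,_) ys f) (Σ-cartesianProduct xs ys f) ⟩
    Σ-list ys (λ y → f (x , y)) + Σ-list xs (λ x → Σ-list ys (λ y → f (x , y))) ∎

  Σ-*ˡ : (a : R) (xs : List A) (f : A → R) → a * Σ-list xs f ≡ Σ-list xs (λ x → a * f x)
  Σ-*ˡ a []       f = zeroʳ a
  Σ-*ˡ a (x ∷ xs) f = trans (distribˡ a _ _) (cong (a * f x +_) (Σ-*ˡ a xs f))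

  Σ-neg : (xs : List A) (f : A → R) → - Σ-list xs f ≡ Σ-list xs (λ x → - f x)
  Σ-neg []       f = ε⁻¹≈ε
  Σ-neg (x ∷ xs) f = trans (sym (⁻¹-∙-comm _ _)) (cong (- f x +_) (Σ-neg xs f))

  Σ-cong : (xs : List A) {f g : A → R} → (∀ {x} → x ∈ xs → f x ≡ g x) → Σ-list xs f ≡ Σ-list xs g
  Σ-cong []       f≗g = refl
  Σ-cong (x ∷ xs) f≗g = cong₂ _+_ (f≗g (here refl)) (Σ-cong xs (λ x∈ → f≗g (there x∈)))

  Σ-foldr : (xs : List A) (f : A → R) → Σ-list xs f ≡ foldr _+_ 0# (map f xs)
  Σ-foldr []       f = refl
  Σ-foldr (x ∷ xs) f = cong (f x +_) (Σ-foldr xs f)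

  Σ-↭ : {xs ys : List A} (f : A → R) → xs ↭ ys → Σ-list xs f ≡ Σ-list ys f
  Σ-↭ {xs = xs} {ys} f xs↭ys = begin
    Σ-list xs f
      ≡⟨ Σ-foldr xs f ⟩
    foldr _+_ 0# (map f xs)
      ≡⟨ foldr-commMonoid (setoid R) +-isCommutativeMonoid (↭⇒↭ₛ (map⁺ f xs↭ys)) ⟩
    foldr _+_ 0# (map f ys)
      ≡⟨ Σ-foldr ys f ⟨
    Σ-list ys f ∎

module Convolution (ℝ : RealField) where
  open RealField ℝ
  open import Data.Nat as ℕ using (ℕ; NonZero)
  import Data.Integer as ℤ
  open import Data.Nat.Coprimality using (Coprime)
  import Data.Nat.Coprimality as Coprime
  open import Data.List using (map)
  open import Data.List.Membership.Propositional using (_∈_)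
  open import Data.Product using (_×_; _,_; proj₁; proj₂)
  open import Algebra.Bundles using (CommutativeRing)
  open import Relation.Binary.PropositionalEquality
  open ≡-Reasoning
  open FieldFacts ℝ
  open Sums ℝ
  open DivisorLists using (factor∣; divisor-nonZero)
  open CoprimeDivisors
  open Möbius using (μ-*)
  open CommutativeRing commutativeRing using (*-assoc; ring; *-commutativeSemigroup)
  open import Algebra.Properties.Ring ring using (-‿distribʳ-*)
  open import Algebra.Properties.CommutativeSemigroup *-commutativeSemigroup using (interchange)

  weight : ℕ → R
  weight d = fromℤ (μ d) * fromℕ d ⁻¹

  weight-* : ∀ {m n} → .{{NonZero m}} → .{{NonZero n}} → Coprime m n →
    weight (m ℕ.* n) ≡ weight m * weight n
  weight-* {m} {n} cop = begin
    fromℤ (μ (m ℕ.* n)) * fromℕ (m ℕ.* n) ⁻¹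
      ≡⟨ cong₂ (λ i r → fromℤ i * r) (μ-* cop) (fromℕ-*-⁻¹ m n) ⟩
    fromℤ (μ m ℤ.* μ n) * (fromℕ m ⁻¹ * fromℕ n ⁻¹)
      ≡⟨ cong (_* (fromℕ m ⁻¹ * fromℕ n ⁻¹)) (fromℤ-* (μ m) (μ n)) ⟩
    fromℤ (μ m) * fromℤ (μ n) * (fromℕ m ⁻¹ * fromℕ n ⁻¹)
      ≡⟨ interchange _ _ _ _ ⟩
    weight m * weight n ∎

  term : R → ℕ → R
  term x d = weight d * B (x * fromℕ d ⁻¹)

  module _ (q b : ℕ) .{{_ : NonZero q}} .{{_ : NonZero b}} (coprime : Coprime q b) (α : R) where

    tripleTerm : (ℕ × ℕ) × ℕ → R
    tripleTerm ((d₁ , d₂) , d') = weight d₁ * term (α * fromℕ d₂) d'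

    -- At d = d₁ d', the summand of K (q b) (α b) is the contribution of the triple:
    -- μ(d)/d factors by multiplicativity, and (α b)/(d₁ d') = (α d₂)/d'.
    term-join : ∀ {t} → t ∈ Triples q b → term (α * fromℕ b) (join t) ≡ tripleTerm t
    term-join {(d₁ , d₂) , d'} t∈ with d₁d₂≡b , d'∣q ← ∈-Triples⁻ {q} {b} t∈ = begin
      weight (d₁ ℕ.* d') * B (α * fromℕ b * fromℕ (d₁ ℕ.* d') ⁻¹)
        ≡⟨ cong₂ (λ w x → w * B x) (weight-* coprime-factors) argument ⟩
      weight d₁ * weight d' * B (α * fromℕ d₂ * fromℕ d' ⁻¹)
        ≡⟨ *-assoc _ _ _ ⟩
      weight d₁ * term (α * fromℕ d₂) d' ∎
      where
      instance
        d₁≢0 : NonZero d₁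
        d₁≢0 = divisor-nonZero (factor∣ d₁d₂≡b)
        d'≢0 : NonZero d'
        d'≢0 = divisor-nonZero d'∣q
      coprime-factors : Coprime d₁ d'
      coprime-factors = coprime-divisors (Coprime.sym coprime) (factor∣ d₁d₂≡b) d'∣q
      argument : α * fromℕ b * fromℕ (d₁ ℕ.* d') ⁻¹ ≡ α * fromℕ d₂ * fromℕ d' ⁻¹
      argument = begin
        α * fromℕ b * fromℕ (d₁ ℕ.* d') ⁻¹
          ≡⟨ cong₂ (λ n r → α * fromℕ n * r) (sym d₁d₂≡b) (fromℕ-*-⁻¹ d₁ d') ⟩
        α * fromℕ (d₁ ℕ.* d₂) * (fromℕ d₁ ⁻¹ * fromℕ d' ⁻¹)
          ≡⟨ cong (λ r → α * r * (fromℕ d₁ ⁻¹ * fromℕ d' ⁻¹)) (fromℕ-* d₁ d₂) ⟩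
        α * (fromℕ d₁ * fromℕ d₂) * (fromℕ d₁ ⁻¹ * fromℕ d' ⁻¹)
          ≡⟨ cancel α (fromℕ d₁) (fromℕ d₂) (fromℕ d' ⁻¹) (fromℕ-nonZero d₁) ⟩
        α * fromℕ d₂ * fromℕ d' ⁻¹ ∎

    sum-over-q : ∀ p → - Σ-list (divisors q) (λ d' → tripleTerm (p , d'))
                         ≡ weight (proj₁ p) * K q (α * fromℕ (proj₂ p))
    sum-over-q (d₁ , d₂) = begin
      - Σ-list (divisors q) (λ d' → weight d₁ * term (α * fromℕ d₂) d')
        ≡⟨ cong -_ (Σ-*ˡ (weight d₁) (divisors q) (term (α * fromℕ d₂))) ⟨
      - (weight d₁ * Σ-list (divisors q) (term (α * fromℕ d₂)))
        ≡⟨ -‿distribʳ-* (weight d₁) _ ⟩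
      weight d₁ * K q (α * fromℕ d₂) ∎

    K-coprime-* : K (q ℕ.* b) (α * fromℕ b)
                  ≡ Σ-list (divisorPairs b) (λ p → weight (proj₁ p) * K q (α * fromℕ (proj₂ p)))
    K-coprime-* = begin
      - Σ-list (divisors (q ℕ.* b)) (term (α * fromℕ b))
        ≡⟨ cong -_ (Σ-↭ (term (α * fromℕ b)) (divisors-coprime-* coprime)) ⟩
      - Σ-list (map join (Triples q b)) (term (α * fromℕ b))
        ≡⟨ cong -_ (Σ-map join (Triples q b) (term (α * fromℕ b))) ⟩
      - Σ-list (Triples q b) (λ t → term (α * fromℕ b) (join t))
        ≡⟨ cong -_ (Σ-cong (Triples q b) term-join) ⟩
      - Σ-list (Triples q b) tripleTerm
        ≡⟨ cong -_ (Σ-cartesianProduct (divisorPairs b) (divisors q) tripleTerm) ⟩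
      - Σ-list (divisorPairs b) (λ p → Σ-list (divisors q) (λ d' → tripleTerm (p , d')))
        ≡⟨ Σ-neg (divisorPairs b) _ ⟩
      Σ-list (divisorPairs b) (λ p → - Σ-list (divisors q) (λ d' → tripleTerm (p , d')))
        ≡⟨ Σ-cong (divisorPairs b) (λ {p} _ → sum-over-q p) ⟩
      Σ-list (divisorPairs b) (λ p → weight (proj₁ p) * K q (α * fromℕ (proj₂ p))) ∎

lemma3p4 : (ℝ : RealField) → let open RealField ℝ in
    (q b : ℕ) → q ≥ 1 → b ≥ 1 → gcd q b ≡ 1 → (α : R) →
    K (q Data.Nat.* b) (α * fromℕ b)
      ≡ Σ-list (divisorPairs b)
          (λ { (d₁ , d₂) → fromℤ (μ d₁) * fromℕ d₁ ⁻¹ * K q (α * fromℕ d₂) })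
lemma3p4 ℝ q b q≥1 b≥1 gcd≡1 α =
  Convolution.K-coprime-* ℝ q b {{>-nonZero q≥1}} {{>-nonZero b≥1}} (gcd≡1⇒coprime gcd≡1) α
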